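{- Let $\mathcal{M}_1=(X_1,\mathcal{N}_1,V_1)$ and $\mathcal{M}_2=(X_2,\mathcal{N}_2,V_2)$ be quasi-discrete neighbourhood models and $\rho$ a modal bisimulation with converse between them with $x_1\rho x_2$. Then for every $n\in\mathbb{N}$ and every path $p:\mathbb{N}\to X_1$ with $p(n)=x_1$ there is a path $q:\mathbb{N}\to X_2$ with $q(n)=x_2$ such that $p(i)\rho q(i)$ for all $i\in\mathbb{N}$; and symmetrically, for every path $q$ on $\mathcal{M}_2$ with $q(n)=x_2$ there is a path $p$ on $\mathcal{M}_1$ with $p(n)=x_1$ such that $p(i)\rho q(i)$ for all $i\in\mathbb{N}$.
   Context: A neighbourhood space $(X,\mathcal{N})$ assigns to each $x\in X$ a filter $\mathcal{N}(x)$ on $X$ with $x\in N$ for all $N\in\mathcal{N}(x)$; it is quasi-discrete if every $x$ has a minimal neighbourhood $\mathcal{N}_{\min}(x)$. A quasi-discrete neighbourhood model $(X,\mathcal{N},V)$ is such a space with a valuation $V:X\to\mathcal{P}(\mathsf{P})$ and index space $\mathbb{N}$ whose neighbourhood system gives $n$ the minimal neighbourhood $\{n,n+1\}$; a path is a continuous map $p:\mathbb{N}\to X$, equivalently $p(n+1)\in\mathcal{N}_{\min}(p(n))$ for all $n$. Induced edge relation $R=\{(x,y)\mid y\in\mathcal{N}_{\min}(x)\}$. A relation $\rho\subseteq X_1\times X_2$ is a modal bisimulation if for every $x_1\rho x_2$: $V_1(x_1)=V_2(x_2)$; if $(x_1,y_1)\in R_1$ then there is $y_2$ with $(x_2,y_2)\in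 R_2$ and $y_1\rho y_2$; if $(x_2,y_2)\in R_2$ then there is $y_1$ with $(x_1,y_1)\in R_1$ and $y_1\rho y_2$. It is a modal bisimulation with converse if additionally for every $x_1\rho x_2$: if $(y_1,x_1)\in R_1$ there is $y_2$ with $(y_2,x_2)\in R_2$ and $y_1\rho y_2$; if $(y_2,x_2)\in R_2$ there is $y_1$ with $(y_1,x_1)\in R_1$ and $y_1\rho y_2$. -}

module Defs where

open import Data.Nat using (ℕ; suc)
open import Data.Product using (Σ; _×_; ∃; _,_)
open import Relation.Binary.PropositionalEquality using (_≡_)
open import Data.Sum using (_⊎_)
open import Level using (0ℓ)
open import Relation.Unary using (Pred; _∈_; _⊆_; _∩_; U)

record IsFilter {X : Set} (F : Pred (Pred X 0ℓ) 0ℓ) : Set₁ where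
  field
    hasTop   : U ∈ F
    upClosed : ∀ {A B : Pred X 0ℓ} → A ∈ F → A ⊆ B → B ∈ F
    ∩-closed : ∀ {A B : Pred X 0ℓ} → A ∈ F → B ∈ F → (A ∩ B) ∈ F

record NbhdSpace (X : Set) : Set₁ where
  field
    𝒩        : X → Pred (Pred X 0ℓ) 0ℓ
    isFilter : ∀ x → IsFilter (𝒩 x)
    pointIn  : ∀ x {N : Pred X 0ℓ} → N ∈ 𝒩 x → x ∈ N

IsMinNbhd : {X : Set} → NbhdSpace X → X → Pred X 0ℓ → Set₁
IsMinNbhd S x M = M ∈ NbhdSpace.𝒩 S x × (∀ {N} → N ∈ NbhdSpace.𝒩 S x → M ⊆ N)

record QDSpace (X : Set) : Set₁ where
  field
    space    : NbhdSpace X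
    Nmin     : X → Pred X 0ℓ
    Nmin-min : ∀ x → IsMinNbhd space x (Nmin x)
  open NbhdSpace space public

record QDModel (P : Set) : Set₂ where
  field
    X   : Set
    qd  : QDSpace X
    V   : X → Pred P 0ℓ
  open QDSpace qd public

-- The index space ℕ: the neighbourhoods of n are the supersets of {n, n+1}.
ℕ-𝒩 : ℕ → Pred (Pred ℕ 0ℓ) 0ℓ
ℕ-𝒩 n N = N n × N (suc n)

-- Continuity (in neighbourhood spaces): preimages of neighbourhoods of p n
-- are neighbourhoods of n.
IsPath : {P : Set} (M : QDModel P) → (ℕ → QDModel.X M) → Set₁
IsPath M p = ∀ n {N} → N ∈ QDModel.𝒩 M (p n) → (λ i → N (p i)) ∈ ℕ-𝒩 n

Edge : {P : Set} (M : QDModel P) → QDModel.X M → QDModel.X M → Set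
Edge M x y = y ∈ QDModel.Nmin M x

_≐_ : {P : Set} → Pred P 0ℓ → Pred P 0ℓ → Set
A ≐ B = A ⊆ B × B ⊆ A

record IsBisimConv {P : Set} (M₁ M₂ : QDModel P)
                   (ρ : QDModel.X M₁ → QDModel.X M₂ → Set) : Set₁ where
  field
    val   : ∀ {x₁ x₂} → ρ x₁ x₂ → QDModel.V M₁ x₁ ≐ QDModel.V M₂ x₂
    forth : ∀ {x₁ x₂} → ρ x₁ x₂ → ∀ {y₁} → Edge M₁ x₁ y₁ → ∃ λ y₂ → Edge M₂ x₂ y₂ × ρ y₁ y₂
    back  : ∀ {x₁ x₂} → ρ x₁ x₂ → ∀ {y₂} → Edge M₂ x₂ y₂ → ∃ λ y₁ → Edge M₁ x₁ y₁ × ρ y₁ y₂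
    forth⁻ : ∀ {x₁ x₂} → ρ x₁ x₂ → ∀ {y₁} → Edge M₁ y₁ x₁ → ∃ λ y₂ → Edge M₂ y₂ x₂ × ρ y₁ y₂
    back⁻  : ∀ {x₁ x₂} → ρ x₁ x₂ → ∀ {y₂} → Edge M₂ y₂ x₂ → ∃ λ y₁ → Edge M₁ y₁ x₁ × ρ y₁ y₂

module Submission where

-- In a quasi-discrete model a path is the same thing as an
-- ℕ-indexed chain of edges: continuity at n, tested against the minimal
-- neighbourhood of p n, says exactly that p (suc n) ∈ Nmin (p n)
-- (`path⇒chain`, `chain⇒path`).  The theorem thus becomes a statement about
-- chains in two abstract relational structures (A, E_A) and (B, E_B) linked by
-- a relation ρ that can match edges forwards (`forth`) and edges backwards
-- into a related point (`forth⁻`).  A chain p with ρ (p n) y is lifted in two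
-- moves: from index 0 onwards the forward condition builds the lift one step
-- at a time (`liftFrom0`); to reach an arbitrary index n we lift the shifted
-- chain p ∘ suc at index n - 1 and prepend one point obtained from the
-- backward condition (`lift`).  The theorem follows by applying `lift` to ρ
-- (using forth and forth⁻) and to its converse (using back and back⁻), and
-- translating between paths and chains.

open import Defs
open import Data.Nat using (ℕ; zero; suc)
open import Data.Product using (Σ; _×_; ∃; _,_; proj₁; proj₂)
open import Function using (flip)
open import Relation.Binary.PropositionalEquality using (_≡_; refl)

Chain : {A : Set} → (A → A → Set) → (ℕ → A) → Set
Chain E p = ∀ i → E (p i) (p (suc i))

_◂_ : {A : Set} → A → (ℕ → A) → ℕ → A
(y ◂ q) zero    = y
(y ◂ q) (suc i) = q i

◂-chain : {A : Set} {E : A → A → Set} {y : A} {q : ℕ → A} →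
          E y (q 0) → Chain E q → Chain E (y ◂ q)
◂-chain e c zero    = e
◂-chain e c (suc i) = c i

◂-pointwise : {A B : Set} {R : A → B → Set} {p : ℕ → A} {y : B} {q : ℕ → B} →
              R (p 0) y → (∀ i → R (p (suc i)) (q i)) → ∀ i → R (p i) ((y ◂ q) i)
◂-pointwise r rs zero    = r
◂-pointwise r rs (suc i) = rs i

module ChainLifting
  {A B : Set} (EA : A → A → Set) (EB : B → B → Set) (ρ : A → B → Set)
  (forth  : ∀ {a b} → ρ a b → ∀ {a'} → EA a a' → ∃ λ b' → EB b b' × ρ a' b')
  (forth⁻ : ∀ {a b} → ρ a b → ∀ {a'} → EA a' a → ∃ λ b' → EB b' b × ρ a' b')
  where

  Lift : (p : ℕ → A) → ℕ → B → Set
  Lift p n y = ∃ λ (q : ℕ → B) → Chain EB q × q n ≡ y × (∀ i → ρ (p i) (q i))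

  liftFrom0 : (p : ℕ → A) → Chain EA p → (y : B) → ρ (p 0) y → Lift p 0 y
  liftFrom0 p c y r = (λ k → proj₁ (step k)) , edge , refl , (λ k → proj₂ (step k))
    where
    step : (k : ℕ) → Σ B (ρ (p k))
    step zero    = y , r
    step (suc k) = let (b' , _ , r') = forth (proj₂ (step k)) (c k) in b' , r'

    edge : Chain EB (λ k → proj₁ (step k))
    edge k = proj₁ (proj₂ (forth (proj₂ (step k)) (c k)))

  -- Lifting through an arbitrary index, by induction on the index: lift the
  -- tail of p one index earlier, then match the first edge backwards.
  lift : (n : ℕ) (p : ℕ → A) → Chain EA p → (y : B) → ρ (p n) y → Lift p n y
  lift zero    p c y r = liftFrom0 p c y r
  lift (suc n) p c y r =
    let (q , cq , qn , rq) = lift n (λ i → p (suc i)) (λ i → c (suc i)) y r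
        (y₀ , e₀ , r₀)     = forth⁻ (rq 0) (c 0)
    in (y₀ ◂ q) , ◂-chain {E = EB} e₀ cq , qn , ◂-pointwise {R = ρ} {p = p} r₀ rq

module _ {P : Set} (M : QDModel P) where
  open QDModel M

  -- Continuity at i against the minimal neighbourhood of p i.
  path⇒chain : (p : ℕ → X) → IsPath M p → Chain (Edge M) p
  path⇒chain p isPath i = proj₂ (isPath i (proj₁ (Nmin-min (p i))))

  -- Every neighbourhood of p n contains p n and Nmin (p n) ∋ p (suc n).
  chain⇒path : (p : ℕ → X) → Chain (Edge M) p → IsPath M p
  chain⇒path p c n N∈ = pointIn (p n) N∈ , proj₂ (Nmin-min (p n)) N∈ (c n)

lemma31 : {P : Set} (M₁ M₂ : QDModel P) (ρ : QDModel.X M₁ → QDModel.X M₂ → Set) →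
    IsBisimConv M₁ M₂ ρ → (x₁ : QDModel.X M₁) (x₂ : QDModel.X M₂) → ρ x₁ x₂ →
    (∀ (n : ℕ) (p : ℕ → QDModel.X M₁) → IsPath M₁ p → p n ≡ x₁ →
    ∃ λ (q : ℕ → QDModel.X M₂) → IsPath M₂ q × q n ≡ x₂ × (∀ i → ρ (p i) (q i)))
    × (∀ (n : ℕ) (q : ℕ → QDModel.X M₂) → IsPath M₂ q → q n ≡ x₂ →
    ∃ λ (p : ℕ → QDModel.X M₁) → IsPath M₁ p × p n ≡ x₁ × (∀ i → ρ (p i) (q i)))
lemma31 M₁ M₂ ρ bisim x₁ x₂ x₁ρx₂ = liftPath₁ , liftPath₂
  where
  open IsBisimConv bisim
  module Lift₁ = ChainLifting (Edge M₁) (Edge M₂) ρ forth forth⁻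
  module Lift₂ = ChainLifting (Edge M₂) (Edge M₁) (flip ρ) back back⁻

  liftPath₁ : ∀ n p → IsPath M₁ p → p n ≡ x₁ →
              ∃ λ q → IsPath M₂ q × q n ≡ x₂ × (∀ i → ρ (p i) (q i))
  liftPath₁ n p isPath refl =
    let (q , cq , qn , rq) = Lift₁.lift n p (path⇒chain M₁ p isPath) x₂ x₁ρx₂
    in q , chain⇒path M₂ q cq , qn , rq

  liftPath₂ : ∀ n q → IsPath M₂ q → q n ≡ x₂ →
              ∃ λ p → IsPath M₁ p × p n ≡ x₁ × (∀ i → ρ (p i) (q i))
  liftPath₂ n q isPath refl =
    let (p , cp , pn , rp) = Lift₂.lift n q (path⇒chain M₂ q isPath) x₁ x₁ρx₂
    in p , chain⇒path M₁ p cp , pn , rp
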